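{- Let $\mathrm{ext}\ge3$, $\mathrm{per}=010^{\mathrm{ext}}$ and $q\in 0101*11\overline{11}*\overline{10010}$. For every two positive integers $a\ge k$ we have $\mathrm{HCD}(\mathrm{per}^k\cdot q\cdot\overleftarrow{\mathrm{per}}^k,\ \mathrm{per}^a\cdot q\cdot\overleftarrow{\mathrm{per}}^a)=\mathrm{Fib}^{ -1}(a/k)$.
   Context: Alphabet $\{0,1\}$, $\overline{0}=1$, $\overline{1}=0$; $\overline{X}$ applies the bar symbolwise, $\overleftarrow{X}=\overline{X[|X|]}\cdots\overline{X[1]}$. For strings $a,b,c$, $a*b*c$ is the set of strings $a\,w_1\,b\,w_2\,c$ with $w_1,w_2$ arbitrary. Hairpin completion (modified definition): a right completion of length $\ell\in[1..|W|]$ transforms $W$ into $W\cdot\overleftarrow{W[1..\ell]}$, a left completion of length $\ell$ transforms $W$ into $\overleftarrow{W[|W|-\ell+1..|W|]}\cdot W$. $\mathrm{HCD}(A,B)$ is the minimum number of hairpin completions transforming $A$ into $B$. Fibonacci: $\mathrm{Fib}(0)=\mathrm{Fib}(1)=1$, $\mathrm{Fib}(i)=\mathrm{Fib}(i-1)+\mathrm{Fib}(i-2)$; $\mathrm{Fib}^{ -1}(z)=\min\{m\in\mathbb{N}:\mathrm{Fib}(m)\ge z\}$. -}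

module Defs where

open import Data.Bool using (Bool; true; false; not)
open import Data.List using (List; []; _∷_; _++_; map; reverse; take; drop; length; replicate; concat)
open import Data.Nat using (ℕ; zero; suc; _+_; _*_; _∸_; _≤_)
open import Data.Product using (_×_; ∃-syntax)
open import Relation.Binary.PropositionalEquality using (_≡_)

-- Binary strings: List Bool, with false = 0 and true = 1.
Str : Set
Str = List Bool

bar : Str → Str
bar = map not

-- reverse complement  ←X = bar(X[|X|]) ⋯ bar(X[1])
rc : Str → Str
rc X = reverse (bar X)

pow : Str → ℕ → Str
pow X n = concat (replicate n X)

-- one hairpin completion step (modified definition), length ℓ ∈ [1..|W|]
data HCStep (W : Str) : Str → Set where
  right : (ℓ : ℕ) → 1 ≤ ℓ → ℓ ≤ length W →
          HCStep W (W ++ rc (take ℓ W))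
  left  : (ℓ : ℕ) → 1 ≤ ℓ → ℓ ≤ length W →
          HCStep W (rc (drop (length W ∸ ℓ) W) ++ W)

data Reach : ℕ → Str → Str → Set where
  done : ∀ {A} → Reach zero A A
  step : ∀ {n A B C} → HCStep A B → Reach n B C → Reach (suc n) A C

HCDis : Str → Str → ℕ → Set
HCDis A B m = Reach m A B × (∀ n → Reach n A B → m ≤ n)

Fib : ℕ → ℕ
Fib zero = 1
Fib (suc zero) = 1
Fib (suc (suc i)) = Fib (suc i) + Fib i

-- Fib⁻¹(a/k) = m  (for k ≥ 1): m is least with Fib m ≥ a/k, i.e. a ≤ Fib m * k
FibInvIs : ℕ → ℕ → ℕ → Set
FibInvIs a k m = (a ≤ Fib m * k) × (∀ m' → a ≤ Fib m' * k → m ≤ m')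

per : ℕ → Str
per ext = false ∷ true ∷ replicate ext false

InQ : Str → Set
InQ q = ∃[ w₁ ] ∃[ w₂ ]
  (q ≡ (false ∷ true ∷ false ∷ true ∷ [])
       ++ w₁ ++ ((true ∷ true ∷ []) ++ bar (true ∷ true ∷ []))
       ++ w₂ ++ bar (true ∷ false ∷ false ∷ true ∷ false ∷ []))

-- Write P = 0 1 0^ext, R = ←P = 1^ext 0 1 and B = P^a q R^a. Of q only the prefix 0101 and the
-- suffix 01101 = bar(10010) matter. P^a has a single 1 per block and R^a a single 0 per block, so these
-- affixes pin every occurrence of q in B to position a|P|; hence each word on the way from P^k q R^k to B
-- is S q T with S a suffix of P^a and T a prefix of R^a. A completion reaching through q copies fewer
-- than |P| letters of q (0101 and 01101 would put two 0s of R^a too close) and lands on a block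
-- boundary, so a right completion turns (|S|, |T|) into (|S|, y′) with y′ at most |S| plus |T| rounded
-- up to whole blocks, and symmetrically on the left. From k blocks on each side, n completions thus
-- reach at most Fib n · k blocks, and completing by whole blocks P^j, R^j attains this.
module Submission where

open import Data.Bool using (Bool; true; false; not)
open import Data.Bool.Properties using (not-involutive)
open import Data.Empty using (⊥; ⊥-elim)
open import Data.List using (List; []; _∷_; _++_; reverse; take; drop; length; replicate)
open import Data.List.Properties
  using (++-assoc; ++-identityʳ; ++-cancelˡ; ∷-injective; length-++; length-++-≤ˡ; length-++-≤ʳ; length-map;
         length-reverse; length-replicate; take++drop≡id; map-++; reverse-++; reverse-map; reverse-involutive)
open import Data.Nat using (ℕ; zero; suc; _+_; _*_; _∸_; _≤_; _<_; z≤n; s≤s; z<s; NonZero; _≤?_; _<?_)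
open import Data.Nat.DivMod using (_/_; _%_; m≡m%n+[m/n]*n; m%n<n; m<n*o⇒m/o<n; [m+kn]%n≡m%n; m<n⇒m%n≡m)
open import Data.Nat.Properties
open import Data.Nat.Tactic.RingSolver using (solve)
open import Data.Product as Product using (_×_; _,_; proj₁; proj₂; ∃-syntax)
open import Data.Sum using (_⊎_; inj₁; inj₂)
open import Relation.Nullary using (yes; no)
open import Relation.Nullary.Decidable using (True; toWitness)
open import Relation.Binary using (tri<; tri≈; tri>)
open import Relation.Binary.PropositionalEquality

open import Defs

module _ {A : Set} where

  ++-injective : ∀ (as cs : List A) {bs ds} → length as ≡ length cs → as ++ bs ≡ cs ++ ds →
                 as ≡ cs × bs ≡ ds
  ++-injective []       []       _   eq = refl , eq
  ++-injective (a ∷ as) (c ∷ cs) len eq with ∷-injective eq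
  ... | refl , eq′ = Product.map₁ (cong (a ∷_)) (++-injective as cs (suc-injective len) eq′)

  ++-split : ∀ (as bs cs ds : List A) → as ++ bs ≡ cs ++ ds → length as ≤ length cs →
             ∃[ zs ] cs ≡ as ++ zs × bs ≡ zs ++ ds
  ++-split []       bs cs       ds eq _        = cs , refl , eq
  ++-split (a ∷ as) bs (c ∷ cs) ds eq (s≤s le) with ∷-injective eq
  ... | refl , eq′ = Product.map₂ (Product.map₁ (cong (a ∷_))) (++-split as bs cs ds eq′ le)

  ++-assoc₄ : ∀ (as bs cs ds : List A) → (as ++ bs ++ cs) ++ ds ≡ (as ++ bs) ++ cs ++ ds
  ++-assoc₄ as bs cs ds = begin
    (as ++ bs ++ cs) ++ ds   ≡⟨ ++-assoc as (bs ++ cs) ds ⟩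
    as ++ (bs ++ cs) ++ ds   ≡⟨ cong (as ++_) (++-assoc bs cs ds) ⟩
    as ++ bs ++ cs ++ ds     ≡⟨ ++-assoc as bs (cs ++ ds) ⟨
    (as ++ bs) ++ cs ++ ds   ∎
    where open ≡-Reasoning

  take-length-++ : ∀ (xs ys : List A) → take (length xs) (xs ++ ys) ≡ xs
  take-length-++ []       ys = refl
  take-length-++ (x ∷ xs) ys = cong (x ∷_) (take-length-++ xs ys)

  drop-length-++ : ∀ (xs ys : List A) → drop (length xs) (xs ++ ys) ≡ ys
  drop-length-++ []       ys = refl
  drop-length-++ (x ∷ xs) ys = drop-length-++ xs ys

true≢false : true ≢ false
true≢false ()

-- Positions count from 0; reading past the end gives false.
_!_ : Str → ℕ → Bool
[]       ! _     = false
(b ∷ _)  ! zero  = b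
(_ ∷ bs) ! suc i = bs ! i

!-++ˡ : ∀ xs {ys i} → i < length xs → (xs ++ ys) ! i ≡ xs ! i
!-++ˡ (x ∷ xs) {i = zero}  _        = refl
!-++ˡ (x ∷ xs) {i = suc i} (s≤s lt) = !-++ˡ xs lt

!-++ʳ : ∀ xs {ys n} i → length xs ≡ n → (xs ++ ys) ! (n + i) ≡ ys ! i
!-++ʳ []       i refl = refl
!-++ʳ (x ∷ xs) i refl = !-++ʳ xs i refl

!-++-here : ∀ xs {b ys} → (xs ++ b ∷ ys) ! length xs ≡ b
!-++-here []       = refl
!-++-here (x ∷ xs) = !-++-here xs

!-replicate-false : ∀ n i → replicate n false ! i ≡ false
!-replicate-false zero    i       = refl
!-replicate-false (suc n) zero    = refl
!-replicate-false (suc n) (suc i) = !-replicate-false n i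

!-ones01-< : ∀ n {r} → r < n → (replicate n true ++ false ∷ true ∷ []) ! r ≡ true
!-ones01-< (suc n) {zero}  _        = refl
!-ones01-< (suc n) {suc r} (s≤s lt) = !-ones01-< n lt

!-ones01-zero : ∀ n → (replicate n true ++ false ∷ true ∷ []) ! n ≡ false
!-ones01-zero zero    = refl
!-ones01-zero (suc n) = !-ones01-zero n

ones01-zero-unique : ∀ n {r} → r < 2 + n → (replicate n true ++ false ∷ true ∷ []) ! r ≡ false → r ≡ n
ones01-zero-unique zero    {zero}        _        _  = refl
ones01-zero-unique zero    {suc zero}    _        ()
ones01-zero-unique zero    {suc (suc r)} (s≤s (s≤s ())) _
ones01-zero-unique (suc n) {zero}        _        ()
ones01-zero-unique (suc n) {suc r}       (s≤s lt) eq = cong suc (ones01-zero-unique n lt eq)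

bar-involutive : ∀ xs → bar (bar xs) ≡ xs
bar-involutive []       = refl
bar-involutive (x ∷ xs) = cong₂ _∷_ (not-involutive x) (bar-involutive xs)

rc-++ : ∀ xs ys → rc (xs ++ ys) ≡ rc ys ++ rc xs
rc-++ xs ys = trans (cong reverse (map-++ not xs ys)) (reverse-++ (bar xs) (bar ys))

rc-involutive : ∀ xs → rc (rc xs) ≡ xs
rc-involutive xs = begin
  reverse (bar (reverse (bar xs))) ≡⟨ cong reverse (reverse-map not (bar xs)) ⟩
  reverse (reverse (bar (bar xs))) ≡⟨ reverse-involutive (bar (bar xs)) ⟩
  bar (bar xs)                     ≡⟨ bar-involutive xs ⟩
  xs                               ∎
  where open ≡-Reasoning

length-rc : ∀ xs → length (rc xs) ≡ length xs
length-rc xs = trans (length-reverse (bar xs)) (length-map not xs)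

rc-replicate : ∀ n b → rc (replicate n b) ≡ replicate n (not b)
rc-replicate zero    b = refl
rc-replicate (suc n) b = begin
  rc (b ∷ replicate n b)               ≡⟨ rc-++ (b ∷ []) (replicate n b) ⟩
  rc (replicate n b) ++ rc (b ∷ [])    ≡⟨ cong (_++ not b ∷ []) (rc-replicate n b) ⟩
  replicate n (not b) ++ not b ∷ []    ≡⟨ replicate-snoc n ⟩
  not b ∷ replicate n (not b)          ∎
  where
    open ≡-Reasoning
    replicate-snoc : ∀ {c} m → replicate m c ++ c ∷ [] ≡ c ∷ replicate m c
    replicate-snoc zero    = refl
    replicate-snoc (suc m) = cong (_ ∷_) (replicate-snoc m)

pow-+ : ∀ X m n → pow X (m + n) ≡ pow X m ++ pow X n
pow-+ X zero    n = refl
pow-+ X (suc m) n = trans (cong (X ++_) (pow-+ X m n)) (sym (++-assoc X (pow X m) (pow X n)))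

length-pow : ∀ X n → length (pow X n) ≡ n * length X
length-pow X zero    = refl
length-pow X (suc n) = trans (length-++ X) (cong (length X +_) (length-pow X n))

rc-pow : ∀ X n → rc (pow X n) ≡ pow (rc X) n
rc-pow X zero    = refl
rc-pow X (suc n) = begin
  rc (X ++ pow X n)             ≡⟨ rc-++ X (pow X n) ⟩
  rc (pow X n) ++ rc X          ≡⟨ cong₂ _++_ (rc-pow X n) (sym (++-identityʳ (rc X))) ⟩
  pow (rc X) n ++ pow (rc X) 1  ≡⟨ sym (pow-+ (rc X) n 1) ⟩
  pow (rc X) (n + 1)            ≡⟨ cong (pow (rc X)) (+-comm n 1) ⟩
  pow (rc X) (suc n)            ∎
  where open ≡-Reasoning

!-pow : ∀ X {a c r} → c < a → r < length X → pow X a ! (c * length X + r) ≡ X ! r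
!-pow X {suc a} {zero}  _        r<X = !-++ˡ X r<X
!-pow X {suc a} {suc c} {r} (s≤s c<a) r<X = begin
  (X ++ pow X a) ! (length X + c * length X + r)   ≡⟨ cong ((X ++ pow X a) !_) (+-assoc (length X) _ r) ⟩
  (X ++ pow X a) ! (length X + (c * length X + r)) ≡⟨ !-++ʳ X _ refl ⟩
  pow X a ! (c * length X + r)                     ≡⟨ !-pow X c<a r<X ⟩
  X ! r                                            ∎
  where open ≡-Reasoning

module _ (N : ℕ) .{{_ : NonZero N}} where

  divMod : ∀ {a p} → p < a * N → ∃[ c ] ∃[ r ] c < a × r < N × p ≡ c * N + r
  divMod {p = p} p<aN =
    p / N , p % N , m<n*o⇒m/o<n p<aN , m%n<n p N , trans (m≡m%n+[m/n]*n p N) (+-comm (p % N) _)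

  remainder-unique : ∀ {c c′ r r′} → r < N → r′ < N → c * N + r ≡ c′ * N + r′ → r ≡ r′
  remainder-unique {c} {c′} {r} {r′} r<N r′<N eq = begin
    r                 ≡⟨ m<n⇒m%n≡m r<N ⟨
    r % N             ≡⟨ [m+kn]%n≡m%n r c N ⟨
    (r + c * N) % N   ≡⟨ cong (_% N) (trans (+-comm r _) (trans eq (+-comm _ r′))) ⟩
    (r′ + c′ * N) % N ≡⟨ [m+kn]%n≡m%n r′ c′ N ⟩
    r′ % N            ≡⟨ m<n⇒m%n≡m r′<N ⟩
    r′                ∎
    where open ≡-Reasoning

  multiple-≤ : ∀ {x j V} → x ≤ V * N → j < N → ∃[ c ] x + j ≡ c * N → x + j ≤ V * N
  multiple-≤ {x} {j} {V} x≤VN j<N (c , x+j≡cN) =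
    subst (_≤ V * N) (sym x+j≡cN) (*-monoˡ-≤ N (≤-pred (*-cancelʳ-< N c (suc V) (begin-strict
      c * N     ≡⟨ x+j≡cN ⟨
      x + j     <⟨ +-mono-≤-< x≤VN j<N ⟩
      V * N + N ≡⟨ +-comm (V * N) N ⟩
      suc V * N ∎))))
    where open ≤-Reasoning

*+<* : ∀ {N a c r} → c < a → r < N → c * N + r < a * N
*+<* {N} {c = c} {r} c<a r<N = begin-strict
  c * N + r  <⟨ +-monoʳ-< (c * N) r<N ⟩
  c * N + N  ≡⟨ +-comm (c * N) N ⟩
  suc c * N  ≤⟨ *-monoˡ-≤ N c<a ⟩
  _          ∎
  where open ≤-Reasoning

fibFrom : ℕ → ℕ → ℕ → ℕ
fibFrom zero    u v = u
fibFrom (suc n) u v = fibFrom n v (u + v)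

fibFrom-Fib : ∀ n i k → fibFrom n (Fib i * k) (Fib (suc i) * k) ≡ Fib (n + i) * k
fibFrom-Fib zero    i k = refl
fibFrom-Fib (suc n) i k = begin
  fibFrom n (Fib (suc i) * k) (Fib i * k + Fib (suc i) * k)  ≡⟨ cong (fibFrom n _) next ⟩
  fibFrom n (Fib (suc i) * k) (Fib (suc (suc i)) * k)        ≡⟨ fibFrom-Fib n (suc i) k ⟩
  Fib (n + suc i) * k                                         ≡⟨ cong (λ j → Fib j * k) (+-suc n i) ⟩
  Fib (suc n + i) * k                                         ∎
  where
    open ≡-Reasoning
    next : Fib i * k + Fib (suc i) * k ≡ Fib (suc (suc i)) * k
    next = trans (+-comm (Fib i * k) _) (sym (*-distribʳ-+ k (Fib (suc i)) (Fib i)))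

fibFrom-scaled : ∀ n k → fibFrom n k k ≡ Fib n * k
fibFrom-scaled n k = begin
  fibFrom n k k                         ≡⟨ cong₂ (fibFrom n) (*-identityˡ k) (*-identityˡ k) ⟨
  fibFrom n (Fib 0 * k) (Fib 1 * k)     ≡⟨ fibFrom-Fib n 0 k ⟩
  Fib (n + 0) * k                       ≡⟨ cong (λ j → Fib j * k) (+-identityʳ n) ⟩
  Fib n * k                             ∎
  where open ≡-Reasoning

module SparseLetter (X : Str) {N : ℕ} .{{_ : NonZero N}} (length-X : length X ≡ N)
                    (b : Bool) (r₀ : ℕ) (r₀<N : r₀ < N) (X!r₀ : X ! r₀ ≡ b)
                    (only-r₀ : ∀ {r} → r < N → X ! r ≡ b → r ≡ r₀) (a : ℕ) where

  length-Xᵃ : length (pow X a) ≡ a * N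
  length-Xᵃ = trans (length-pow X a) (cong (a *_) length-X)

  !-Xᵃ : ∀ {c r} → c < a → r < N → pow X a ! (c * N + r) ≡ X ! r
  !-Xᵃ {c} {r} c<a r<N =
    subst (λ n → pow X a ! (c * n + r) ≡ X ! r) length-X (!-pow X c<a (subst (r <_) (sym length-X) r<N))

  position : ∀ {p} → p < a * N → pow X a ! p ≡ b → ∃[ c ] c < a × p ≡ c * N + r₀
  position p<aN Xᵃ!p with divMod N {a} p<aN
  ... | c , r , c<a , r<N , refl = c , c<a , cong (c * N +_) (only-r₀ r<N (trans (sym (!-Xᵃ c<a r<N)) Xᵃ!p))

  spacing : ∀ U G V → pow X a ≡ U ++ b ∷ G ++ b ∷ V → N ≤ suc (length G)
  spacing U G V Xᵃ≡ with N ≤? suc (length G)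
  ... | yes N≤gap = N≤gap
  ... | no  N≰gap = ⊥-elim (0≢1+n (sym (remainder-unique N {c} {c′} (≰⇒> N≰gap) (≤-<-trans z≤n r₀<N) shift)))
    where
      g : ℕ
      g = suc (length G)
      total : length U + g + suc (length V) ≡ a * N
      total = begin
        length U + g + suc (length V)           ≡⟨ +-assoc (length U) g _ ⟩
        length U + suc (length G + suc (length V)) ≡⟨ cong (λ n → length U + suc n) (length-++ G) ⟨
        length U + length (b ∷ G ++ b ∷ V)      ≡⟨ length-++ U ⟨
        length (U ++ b ∷ G ++ b ∷ V)            ≡⟨ cong length Xᵃ≡ ⟨
        length (pow X a)                        ≡⟨ length-Xᵃ ⟩
        a * N                                   ∎
        where open ≡-Reasoning
      second-in : length U + g < a * N
      second-in = subst (length U + g <_) total (m<m+n (length U + g) z<s)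
      first-in : length U < a * N
      first-in = ≤-<-trans (m≤m+n (length U) g) second-in
      Xᵃ!first : pow X a ! length U ≡ b
      Xᵃ!first = trans (cong (_! length U) Xᵃ≡) (!-++-here U)
      Xᵃ!second : pow X a ! (length U + g) ≡ b
      Xᵃ!second = trans (cong (_! (length U + g)) Xᵃ≡) (trans (!-++ʳ U g refl) (!-++-here G))
      first : ∃[ c ] c < a × length U ≡ c * N + r₀
      first = position first-in Xᵃ!first
      second : ∃[ c ] c < a × length U + g ≡ c * N + r₀
      second = position second-in Xᵃ!second
      c c′ : ℕ
      c = proj₁ first
      c′ = proj₁ second
      p₀ : length U ≡ c * N + r₀
      p₀ = proj₂ (proj₂ first)
      p₁ : length U + g ≡ c′ * N + r₀
      p₁ = proj₂ (proj₂ second)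
      shift : c * N + g ≡ c′ * N + 0
      shift = +-cancelʳ-≡ r₀ _ _ (begin
        c * N + g + r₀     ≡⟨ +-assoc (c * N) g r₀ ⟩
        c * N + (g + r₀)   ≡⟨ cong (c * N +_) (+-comm g r₀) ⟩
        c * N + (r₀ + g)   ≡⟨ +-assoc (c * N) r₀ g ⟨
        c * N + r₀ + g     ≡⟨ cong (_+ g) p₀ ⟨
        length U + g       ≡⟨ p₁ ⟩
        c′ * N + r₀        ≡⟨ cong (_+ r₀) (+-identityʳ (c′ * N)) ⟨
        c′ * N + 0 + r₀    ∎)
        where open ≡-Reasoning

  aligned : ∀ U V {M M′} → pow X a ≡ U ++ V ++ M → pow X a ≡ V ++ M′ → N ≤ length V →
            ∃[ c ] length U ≡ c * N
  aligned U V {M} {M′} Xᵃ≡ Xᵃ≡′ N≤V =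
    Product.map₂ (λ p → +-cancelʳ-≡ r₀ _ _ (proj₂ p)) (position inside Xᵃ!occurrence)
    where
      r₀<V : r₀ < length V
      r₀<V = <-≤-trans r₀<N N≤V
      length-Xᵃ≡ : ∀ A B → pow X a ≡ A ++ B → length A + length B ≡ a * N
      length-Xᵃ≡ A B eq = trans (sym (length-++ A)) (trans (cong length (sym eq)) length-Xᵃ)
      positive : ∀ {n} → r₀ < n * N → 0 < n
      positive {suc n} _ = z<s
      0<a : 0 < a
      0<a = positive (<-≤-trans r₀<V (subst (length V ≤_) (length-Xᵃ≡ V M′ Xᵃ≡′) (m≤m+n _ _)))
      V!r₀ : V ! r₀ ≡ b
      V!r₀ = trans (sym (!-++ˡ V r₀<V)) (trans (cong (_! r₀) (sym Xᵃ≡′)) (trans (!-Xᵃ 0<a r₀<N) X!r₀))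
      Xᵃ!occurrence : pow X a ! (length U + r₀) ≡ b
      Xᵃ!occurrence = trans (cong (_! (length U + r₀)) Xᵃ≡) (trans (!-++ʳ U r₀ refl) (trans (!-++ˡ V r₀<V) V!r₀))
      inside : length U + r₀ < a * N
      inside = begin-strict
        length U + r₀                 <⟨ +-monoʳ-< (length U) r₀<V ⟩
        length U + length V           ≤⟨ +-monoʳ-≤ (length U) (m≤m+n (length V) (length M)) ⟩
        length U + (length V + length M) ≡⟨ cong (length U +_) (length-++ V) ⟨
        length U + length (V ++ M)    ≡⟨ length-Xᵃ≡ U (V ++ M) Xᵃ≡ ⟩
        a * N                         ∎
        where open ≤-Reasoning

Reach⇒zero : ∀ {W C} → Reach zero W C → W ≡ C
Reach⇒zero done = refl

Reach⇒infix : ∀ {n W C} → Reach n W C → ∃[ L ] ∃[ M ] C ≡ L ++ W ++ M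
Reach⇒infix {W = W} done = [] , [] , sym (++-identityʳ W)
Reach⇒infix {W = W} (step (right ℓ _ _) r) with Reach⇒infix r
... | L , M , C≡ = L , rc (take ℓ W) ++ M , trans C≡ (cong (L ++_) (++-assoc W _ M))
Reach⇒infix {W = W} (step (left ℓ _ _) r) with Reach⇒infix r
... | L , M , C≡ = L ++ X , M , trans C≡ (trans (cong (L ++_) (++-assoc X W M)) (sym (++-assoc L X _)))
  where X = rc (drop (length W ∸ ℓ) W)

module Blocks (P q : Str) (P-nonempty : 1 ≤ length P) where

  Block : ℕ → ℕ → Str
  Block X Y = pow P X ++ q ++ pow (rc P) Y

  private
    N : ℕ
    N = length P

    length-rcᵖ : ∀ j → length (pow (rc P) j) ≡ j * N
    length-rcᵖ j = trans (length-pow (rc P) j) (cong (j *_) (length-rc P))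

    1≤*N : ∀ {j} → 1 ≤ j → 1 ≤ j * N
    1≤*N 1≤j = *-mono-≤ 1≤j P-nonempty

  right-block-completion : ∀ X Y {j Y′} → 1 ≤ j → j ≤ X → Y + j ≡ Y′ → HCStep (Block X Y) (Block X Y′)
  right-block-completion X Y {j} {Y′} 1≤j j≤X refl =
    subst (HCStep W) extended (right (j * N) (1≤*N 1≤j) jN≤W)
    where
      open ≡-Reasoning
      W : Str
      W = Block X Y
      r : ℕ
      r = proj₁ (m≤n⇒∃[o]m+o≡n j≤X)
      W≡ : W ≡ pow P j ++ (pow P r ++ q ++ pow (rc P) Y)
      W≡ = begin
        pow P X ++ q ++ pow (rc P) Y                 ≡⟨ cong (λ n → pow P n ++ q ++ pow (rc P) Y)
                                                          (proj₂ (m≤n⇒∃[o]m+o≡n j≤X)) ⟨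
        pow P (j + r) ++ q ++ pow (rc P) Y           ≡⟨ cong (_++ q ++ pow (rc P) Y) (pow-+ P j r) ⟩
        (pow P j ++ pow P r) ++ q ++ pow (rc P) Y    ≡⟨ ++-assoc (pow P j) (pow P r) _ ⟩
        pow P j ++ (pow P r ++ q ++ pow (rc P) Y)    ∎
      prefix : take (j * N) W ≡ pow P j
      prefix = begin
        take (j * N) W                               ≡⟨ cong₂ take (length-pow P j) (sym W≡) ⟨
        take (length (pow P j)) (pow P j ++ _)       ≡⟨ take-length-++ (pow P j) _ ⟩
        pow P j                                      ∎
      extended : W ++ rc (take (j * N) W) ≡ Block X (Y + j)
      extended = begin
        W ++ rc (take (j * N) W)                     ≡⟨ cong (λ Z → W ++ rc Z) prefix ⟩
        W ++ rc (pow P j)                            ≡⟨ cong (W ++_) (rc-pow P j) ⟩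
        (pow P X ++ q ++ pow (rc P) Y) ++ pow (rc P) j ≡⟨ ++-assoc (pow P X) _ _ ⟩
        pow P X ++ (q ++ pow (rc P) Y) ++ pow (rc P) j ≡⟨ cong (pow P X ++_) (++-assoc q _ _) ⟩
        pow P X ++ q ++ pow (rc P) Y ++ pow (rc P) j ≡⟨ cong (λ Z → pow P X ++ q ++ Z) (pow-+ (rc P) Y j) ⟨
        Block X (Y + j)                              ∎
      jN≤W : j * N ≤ length W
      jN≤W = ≤-trans (≤-trans (*-monoˡ-≤ N j≤X) (≤-reflexive (sym (length-pow P X))))
                     (length-++-≤ˡ (pow P X))

  left-block-completion : ∀ X Y {j X′} → 1 ≤ j → j ≤ Y → j + X ≡ X′ → HCStep (Block X Y) (Block X′ Y)
  left-block-completion X Y {j} {X′} 1≤j j≤Y refl =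
    subst (HCStep W) extended (left (j * N) (1≤*N 1≤j) jN≤W)
    where
      open ≡-Reasoning
      W : Str
      W = Block X Y
      r : ℕ
      r = proj₁ (m≤n⇒∃[o]m+o≡n j≤Y)
      front : Str
      front = pow P X ++ q ++ pow (rc P) r
      W≡ : W ≡ front ++ pow (rc P) j
      W≡ = begin
        pow P X ++ q ++ pow (rc P) Y                 ≡⟨ cong (λ n → pow P X ++ q ++ pow (rc P) n)
                                                          (trans (+-comm r j) (proj₂ (m≤n⇒∃[o]m+o≡n j≤Y))) ⟨
        pow P X ++ q ++ pow (rc P) (r + j)           ≡⟨ cong (λ Z → pow P X ++ q ++ Z) (pow-+ (rc P) r j) ⟩
        pow P X ++ q ++ pow (rc P) r ++ pow (rc P) j ≡⟨ cong (pow P X ++_) (++-assoc q _ _) ⟨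
        pow P X ++ (q ++ pow (rc P) r) ++ pow (rc P) j ≡⟨ ++-assoc (pow P X) _ _ ⟨
        front ++ pow (rc P) j                        ∎
      length-W : length W ≡ length front + j * N
      length-W = trans (cong length W≡) (trans (length-++ front) (cong (length front +_) (length-rcᵖ j)))
      suffix : drop (length W ∸ j * N) W ≡ pow (rc P) j
      suffix = begin
        drop (length W ∸ j * N) W                    ≡⟨ cong₂ drop (trans (cong (_∸ j * N) length-W)
                                                                             (m+n∸n≡m _ (j * N))) W≡ ⟩
        drop (length front) (front ++ pow (rc P) j)  ≡⟨ drop-length-++ front _ ⟩
        pow (rc P) j                                 ∎
      extended : rc (drop (length W ∸ j * N) W) ++ W ≡ Block (j + X) Y
      extended = begin
        rc (drop (length W ∸ j * N) W) ++ W          ≡⟨ cong (λ Z → rc Z ++ W) suffix ⟩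
        rc (pow (rc P) j) ++ W                       ≡⟨ cong (_++ W) (trans (rc-pow (rc P) j)
                                                                             (cong (λ Z → pow Z j) (rc-involutive P))) ⟩
        pow P j ++ pow P X ++ q ++ pow (rc P) Y      ≡⟨ ++-assoc (pow P j) (pow P X) _ ⟨
        (pow P j ++ pow P X) ++ q ++ pow (rc P) Y    ≡⟨ cong (_++ q ++ pow (rc P) Y) (pow-+ P j X) ⟨
        Block (j + X) Y                              ∎
      jN≤W : j * N ≤ length W
      jN≤W = subst (j * N ≤_) (sym length-W) (m≤n+m (j * N) (length front))

  reach-by-blocks : ∀ t {U V a} → 1 ≤ U → U ≤ V → fibFrom (suc t) U V < a → a ≤ fibFrom (2 + t) U V →
                    Reach (2 + t) (Block U V) (Block a a) × Reach (2 + t) (Block V U) (Block a a)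
  reach-by-blocks zero {U} {V} {a} 1≤U U≤V V<a a≤U+V =
    step (left-block-completion U V 1≤a∸U a∸U≤V (m∸n+n≡m U≤a))
         (step (right-block-completion a V 1≤a∸V (m∸n≤m a V) (m+[n∸m]≡n V≤a)) done) ,
    step (right-block-completion V U 1≤a∸U a∸U≤V (m+[n∸m]≡n U≤a))
         (step (left-block-completion V a 1≤a∸V (m∸n≤m a V) (m∸n+n≡m V≤a)) done)
    where
      V≤a : V ≤ a
      V≤a = <⇒≤ V<a
      U≤a : U ≤ a
      U≤a = ≤-trans U≤V V≤a
      1≤a∸U : 1 ≤ a ∸ U
      1≤a∸U = m<n⇒0<n∸m (≤-<-trans U≤V V<a)
      1≤a∸V : 1 ≤ a ∸ V
      1≤a∸V = m<n⇒0<n∸m V<a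
      a∸U≤V : a ∸ U ≤ V
      a∸U≤V = m≤n+o⇒m∸n≤o a U a≤U+V
  reach-by-blocks (suc t) {U} {V} {a} 1≤U U≤V lo hi =
    step (left-block-completion U V 1≤V ≤-refl (+-comm V U)) (proj₂ next) ,
    step (right-block-completion V U 1≤V ≤-refl refl) (proj₁ next)
    where
      1≤V : 1 ≤ V
      1≤V = ≤-trans 1≤U U≤V
      next : Reach (2 + t) (Block V (U + V)) (Block a a) × Reach (2 + t) (Block (U + V) V) (Block a a)
      next = reach-by-blocks t 1≤V (m≤n+m V U) lo hi

  reach-Fib⁻¹ : ∀ {a k m} → 1 ≤ k → k ≤ a → FibInvIs a k m → Reach m (Block k k) (Block a a)
  reach-Fib⁻¹ {a} {k} {zero} _ k≤a (a≤k , _) =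
    subst (λ n → Reach 0 (Block k k) (Block n n)) (≤-antisym k≤a (subst (a ≤_) (*-identityˡ k) a≤k)) done
  reach-Fib⁻¹ {m = suc zero} _ _ (a≤k , minimal) with minimal 0 a≤k
  ... | ()
  reach-Fib⁻¹ {a} {k} {suc (suc t)} 1≤k _ (a≤Fib , minimal) =
    proj₁ (reach-by-blocks t 1≤k ≤-refl below (subst (a ≤_) (sym (fibFrom-scaled (2 + t) k)) a≤Fib))
    where
      below : fibFrom (suc t) k k < a
      below = subst (_< a) (sym (fibFrom-scaled (suc t) k))
                    (≰⇒> λ a≤ → <-irrefl refl (minimal (suc t) a≤))

module LowerBound (d : ℕ) (q u v : Str)
            (q-prefix : q ≡ false ∷ true ∷ false ∷ true ∷ u)
            (q-suffix : q ≡ v ++ false ∷ true ∷ true ∷ false ∷ true ∷ [])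
            (a : ℕ) where

  ext N : ℕ
  ext = 3 + d
  N = 2 + ext

  P R Pᵃ Rᵃ B : Str
  P = per ext
  R = rc P
  Pᵃ = pow P a
  Rᵃ = pow R a
  B = Pᵃ ++ q ++ Rᵃ

  length-P : length P ≡ N
  length-P = cong (2 +_) (length-replicate ext)

  R≡ : R ≡ replicate ext true ++ false ∷ true ∷ []
  R≡ = trans (rc-++ (false ∷ true ∷ []) (replicate ext false)) (cong (_++ false ∷ true ∷ []) (rc-replicate ext false))

  length-R : length R ≡ N
  length-R = trans (length-rc P) length-P

  P-one-unique : ∀ {r} → r < N → P ! r ≡ true → r ≡ 1
  P-one-unique {zero}        _ ()
  P-one-unique {suc zero}    _ _  = refl
  P-one-unique {suc (suc r)} _ eq = ⊥-elim (true≢false (trans (sym eq) (!-replicate-false ext r)))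

  R-zero-unique : ∀ {r} → r < N → R ! r ≡ false → r ≡ ext
  R-zero-unique r<N eq = ones01-zero-unique ext r<N (trans (cong (_! _) (sym R≡)) eq)

  module P-ones = SparseLetter P length-P true 1 (s≤s (s≤s z≤n)) refl P-one-unique a
  module R-zeros = SparseLetter R length-R false ext (n≤1+n (suc ext))
                     (trans (cong (_! ext) R≡) (!-ones01-zero ext)) R-zero-unique a

  q!0 : q ! 0 ≡ false
  q!0 = cong (_! 0) q-prefix

  q!1 : q ! 1 ≡ true
  q!1 = cong (_! 1) q-prefix

  q!3 : q ! 3 ≡ true
  q!3 = cong (_! 3) q-prefix

  length-q : length q ≡ length v + 5
  length-q = trans (cong length q-suffix) (length-++ v)

  q!suffix : ∀ i → q ! (length v + i) ≡ (false ∷ true ∷ true ∷ false ∷ true ∷ []) ! i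
  q!suffix i = trans (cong (_! (length v + i)) q-suffix) (!-++ʳ v i refl)

  in-suffix : ∀ i {i<5 : True (i <? 5)} → length v + i < length q
  in-suffix i {i<5} = subst (length v + i <_) (sym length-q) (+-monoʳ-< (length v) (toWitness i<5))

  in-q : ∀ i {i<5 : True (i <? 5)} → i < length q
  in-q i {i<5} = ≤-trans (toWitness i<5) (subst (5 ≤_) (sym length-q) (m≤n+m 5 (length v)))

  B!Pᵃ : ∀ {i} → i < a * N → B ! i ≡ Pᵃ ! i
  B!Pᵃ i<aN = !-++ˡ Pᵃ (subst (_ <_) (sym P-ones.length-Xᵃ) i<aN)

  B!q : ∀ {i} → i < length q → B ! (a * N + i) ≡ q ! i
  B!q i<q = trans (!-++ʳ Pᵃ _ P-ones.length-Xᵃ) (!-++ˡ q i<q)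

  B!Rᵃ : ∀ i → B ! (a * N + (length v + 5 + i)) ≡ Rᵃ ! i
  B!Rᵃ i = trans (!-++ʳ Pᵃ _ P-ones.length-Xᵃ) (!-++ʳ q i length-q)

  after-q-bound : ∀ s → a * N + s + length q ≤ length B → s ≤ a * N
  after-q-bound s fits = +-cancelˡ-≤ (a * N + length q) _ _ (begin
    a * N + length q + s            ≡⟨ +-assoc (a * N) (length q) s ⟩
    a * N + (length q + s)          ≡⟨ cong (a * N +_) (+-comm (length q) s) ⟩
    a * N + (s + length q)          ≡⟨ +-assoc (a * N) s (length q) ⟨
    a * N + s + length q            ≤⟨ fits ⟩
    length (Pᵃ ++ q ++ Rᵃ)          ≡⟨ length-++ Pᵃ ⟩
    length Pᵃ + length (q ++ Rᵃ)    ≡⟨ cong₂ _+_ P-ones.length-Xᵃ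
                                                 (trans (length-++ q) (cong (length q +_) R-zeros.length-Xᵃ)) ⟩
    a * N + (length q + a * N)      ≡⟨ +-assoc (a * N) (length q) (a * N) ⟨
    a * N + length q + a * N        ∎)
    where open ≤-Reasoning

  q-not-before : ∀ {o} → (∀ {i} → i < length q → B ! (o + i) ≡ q ! i) → o < a * N → ⊥
  q-not-before {o} occ o<aN with m≤n⇒m<n∨m≡n o<aN
  ... | inj₂ 1+o≡aN = true≢false (begin
    true              ≡⟨ q!1 ⟨
    q ! 1             ≡⟨ occ (in-q 1) ⟨
    B ! (o + 1)       ≡⟨ cong (B !_) (trans (+-comm o 1) (trans 1+o≡aN (sym (+-identityʳ _)))) ⟩
    B ! (a * N + 0)   ≡⟨ B!q (in-q 0) ⟩
    q ! 0             ≡⟨ q!0 ⟩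
    false             ∎)
    where open ≡-Reasoning
  ... | inj₁ 2+o≤aN = true≢false (begin
    true              ≡⟨ q!3 ⟨
    q ! 3             ≡⟨ occ (in-q 3) ⟨
    B ! (o + 3)       ≡⟨ cong (λ n → B ! (n + 3)) o≡cN ⟩
    B ! (c * N + 3)   ≡⟨ B!Pᵃ (*+<* c<a 3<N) ⟩
    Pᵃ ! (c * N + 3)  ≡⟨ P-ones.!-Xᵃ c<a 3<N ⟩
    false             ∎)
    where
      open ≡-Reasoning
      3<N : 3 < N
      3<N = m≤m+n 4 (suc d)
      o+1<aN : o + 1 < a * N
      o+1<aN = subst (_< a * N) (+-comm 1 o) 2+o≤aN
      one : ∃[ c ] c < a × o + 1 ≡ c * N + 1
      one = P-ones.position o+1<aN (trans (sym (B!Pᵃ o+1<aN)) (trans (occ (in-q 1)) q!1))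
      c : ℕ
      c = proj₁ one
      c<a : c < a
      c<a = proj₁ (proj₂ one)
      o≡cN : o ≡ c * N
      o≡cN = +-cancelʳ-≡ 1 _ _ (proj₂ (proj₂ one))

  q-not-after : ∀ {o} → (∀ {i} → i < length q → B ! (o + i) ≡ q ! i) → o + length q ≤ length B →
                a * N < o → ⊥
  q-not-after occ fits aN<o with m≤n⇒∃[o]m+o≡n aN<o
  ... | zero , refl = true≢false (begin
    true                                     ≡⟨ q!suffix 4 ⟨
    q ! (length v + 4)                       ≡⟨ B!q (in-suffix 4) ⟨
    B ! (a * N + (length v + 4))             ≡⟨ cong (B !_) (shift (a * N) (length v)) ⟨
    B ! (suc (a * N) + 0 + (length v + 3))   ≡⟨ occ (in-suffix 3) ⟩
    q ! (length v + 3)                       ≡⟨ q!suffix 3 ⟩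
    false                                    ∎)
    where
      open ≡-Reasoning
      shift : ∀ A m → suc A + 0 + (m + 3) ≡ A + (m + 4)
      shift A m = solve (A ∷ m ∷ [])
  ... | suc t , refl = true≢false (begin
    true                                              ≡⟨ trans (R-zeros.!-Xᵃ c<a d<N) R!d ⟨
    Rᵃ ! (c * N + d)                                  ≡⟨ B!Rᵃ (c * N + d) ⟨
    B ! (a * N + (length v + 5 + (c * N + d)))        ≡⟨ cong (B !_) (shift₀ (a * N) (c * N) (length v)) ⟨
    B ! (suc (a * N) + suc (c * N + ext) + (length v + 0)) ≡⟨ cong (λ n → B ! (suc (a * N) + suc n + (length v + 0))) t≡ ⟨
    B ! (suc (a * N) + suc t + (length v + 0))        ≡⟨ occ (in-suffix 0) ⟩
    q ! (length v + 0)                                ≡⟨ q!suffix 0 ⟩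
    false                                             ∎)
    where
      open ≡-Reasoning
      d<N : d < N
      d<N = m≤n+m (suc d) 4
      R!d : R ! d ≡ true
      R!d = trans (cong (_! d) R≡) (!-ones01-< ext (m≤n+m (suc d) 2))
      shift₃ : ∀ A T m → suc A + suc T + (m + 3) ≡ A + (m + 5 + T)
      shift₃ A T m = solve (A ∷ T ∷ m ∷ [])
      shift₀ : ∀ A C m → suc A + suc (C + (3 + d)) + (m + 0) ≡ A + (m + 5 + (C + d))
      shift₀ A C m = solve (A ∷ C ∷ m ∷ d ∷ [])
      Rᵃ!t : Rᵃ ! t ≡ false
      Rᵃ!t = trans (sym (B!Rᵃ t)) (trans (cong (B !_) (sym (shift₃ (a * N) t (length v))))
                                         (trans (occ (in-suffix 3)) (q!suffix 3)))
      t<aN : t < a * N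
      t<aN = ≤-trans (n≤1+n (suc t))
                     (after-q-bound (suc (suc t)) (subst (λ n → n + length q ≤ length B) (sym (+-suc (a * N) (suc t))) fits))
      zero-at-t : ∃[ c ] c < a × t ≡ c * N + ext
      zero-at-t = R-zeros.position t<aN Rᵃ!t
      c : ℕ
      c = proj₁ zero-at-t
      c<a : c < a
      c<a = proj₁ (proj₂ zero-at-t)
      t≡ : t ≡ c * N + ext
      t≡ = proj₂ (proj₂ zero-at-t)

  occurrence : ∀ L {M} → B ≡ L ++ q ++ M → ∀ {i} → i < length q → B ! (length L + i) ≡ q ! i
  occurrence L B≡ i<q = trans (cong (_! _) B≡) (trans (!-++ʳ L _ refl) (!-++ˡ q i<q))

  occurrence-fits : ∀ L {M} → B ≡ L ++ q ++ M → length L + length q ≤ length B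
  occurrence-fits L {M} B≡ = begin
    length L + length q                ≤⟨ +-monoʳ-≤ (length L) (m≤m+n (length q) (length M)) ⟩
    length L + (length q + length M)   ≡⟨ cong (length L +_) (length-++ q) ⟨
    length L + length (q ++ M)         ≡⟨ length-++ L ⟨
    length (L ++ q ++ M)               ≡⟨ cong length B≡ ⟨
    length B                           ∎
    where open ≤-Reasoning

  q-occurs-once : ∀ L {M} → B ≡ L ++ q ++ M → length L ≡ a * N
  q-occurs-once L B≡ with <-cmp (length L) (a * N)
  ... | tri< o<aN _ _ = ⊥-elim (q-not-before (occurrence L B≡) o<aN)
  ... | tri≈ _ o≡aN _ = o≡aN
  ... | tri> _ _ aN<o = ⊥-elim (q-not-after (occurrence L B≡) (occurrence-fits L B≡) aN<o)

  occurrence-split : ∀ L S T M → B ≡ L ++ (S ++ q ++ T) ++ M → Pᵃ ≡ L ++ S × Rᵃ ≡ T ++ M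
  occurrence-split L S T M B≡ = Product.map₂ (++-cancelˡ q Rᵃ (T ++ M)) halves
    where
      B≡′ : Pᵃ ++ q ++ Rᵃ ≡ (L ++ S) ++ q ++ T ++ M
      B≡′ = begin
        B                                ≡⟨ B≡ ⟩
        L ++ (S ++ q ++ T) ++ M          ≡⟨ cong (L ++_) (++-assoc S (q ++ T) M) ⟩
        L ++ S ++ (q ++ T) ++ M          ≡⟨ cong (λ Z → L ++ S ++ Z) (++-assoc q T M) ⟩
        L ++ S ++ q ++ T ++ M            ≡⟨ ++-assoc L S _ ⟨
        (L ++ S) ++ q ++ T ++ M          ∎
        where open ≡-Reasoning
      halves : Pᵃ ≡ L ++ S × q ++ Rᵃ ≡ q ++ T ++ M
      halves = ++-injective Pᵃ (L ++ S) (trans P-ones.length-Xᵃ (sym (q-occurs-once (L ++ S) B≡′))) B≡′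

  N≰4 : N ≤ 4 → ⊥
  N≰4 (s≤s (s≤s (s≤s (s≤s ()))))

  rc-q-prefix-short : ∀ {Z D E U M} → q ++ E ≡ Z ++ D → Rᵃ ≡ (U ++ rc Z) ++ M → length Z < 4
  rc-q-prefix-short {Z} {D} {E} {U} {M} qE≡ Rᵃ≡ with 4 ≤? length Z
  ... | no 4≰Z = ≰⇒> 4≰Z
  ... | yes 4≤Z =
    ⊥-elim (N≰4 (≤-trans (R-zeros.spacing (U ++ rc Z′) (true ∷ []) (true ∷ M) Rᵃ≡′) (s≤s (s≤s z≤n))))
    where
      π : Str
      π = false ∷ true ∷ false ∷ true ∷ []
      Z′ : Str
      Z′ = proj₁ (++-split π (u ++ E) Z D (trans (sym (cong (_++ E) q-prefix)) qE≡) 4≤Z)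
      Z≡ : Z ≡ π ++ Z′
      Z≡ = proj₁ (proj₂ (++-split π (u ++ E) Z D (trans (sym (cong (_++ E) q-prefix)) qE≡) 4≤Z))
      Rᵃ≡′ : Rᵃ ≡ (U ++ rc Z′) ++ false ∷ true ∷ false ∷ true ∷ M
      Rᵃ≡′ = begin
        Rᵃ                             ≡⟨ Rᵃ≡ ⟩
        (U ++ rc Z) ++ M               ≡⟨ cong (λ Y → (U ++ Y) ++ M) (trans (cong rc Z≡) (rc-++ π Z′)) ⟩
        (U ++ rc Z′ ++ π) ++ M      ≡⟨ ++-assoc₄ U (rc Z′) π M ⟩
        (U ++ rc Z′) ++ π ++ M      ∎
        where open ≡-Reasoning

  q-suffix-short : ∀ {Z D E U M} → E ++ q ≡ D ++ Z → Rᵃ ≡ (U ++ Z) ++ M → length Z < 5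
  q-suffix-short {Z} {D} {E} {U} {M} Eq≡ Rᵃ≡ with 5 ≤? length Z
  ... | no 5≰Z = ≰⇒> 5≰Z
  ... | yes 5≤Z =
    ⊥-elim (N≰4 (≤-trans (R-zeros.spacing (U ++ Z″) (true ∷ true ∷ []) (true ∷ M) Rᵃ≡′) (s≤s (s≤s (s≤s z≤n)))))
    where
      ρ : Str
      ρ = false ∷ true ∷ true ∷ false ∷ true ∷ []
      DZ≡ : D ++ Z ≡ (E ++ v) ++ ρ
      DZ≡ = trans (sym Eq≡) (trans (cong (E ++_) q-suffix) (sym (++-assoc E v ρ)))
      D≤Ev : length D ≤ length (E ++ v)
      D≤Ev = +-cancelʳ-≤ 5 _ _ (begin
        length D + 5                 ≤⟨ +-monoʳ-≤ (length D) 5≤Z ⟩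
        length D + length Z          ≡⟨ length-++ D ⟨
        length (D ++ Z)              ≡⟨ cong length DZ≡ ⟩
        length ((E ++ v) ++ ρ)       ≡⟨ length-++ (E ++ v) ⟩
        length (E ++ v) + 5          ∎)
        where open ≤-Reasoning
      Z″ : Str
      Z″ = proj₁ (++-split D Z (E ++ v) ρ DZ≡ D≤Ev)
      Z≡ : Z ≡ Z″ ++ ρ
      Z≡ = proj₂ (proj₂ (++-split D Z (E ++ v) ρ DZ≡ D≤Ev))
      Rᵃ≡′ : Rᵃ ≡ (U ++ Z″) ++ false ∷ true ∷ true ∷ false ∷ true ∷ M
      Rᵃ≡′ = begin
        Rᵃ                   ≡⟨ Rᵃ≡ ⟩
        (U ++ Z) ++ M        ≡⟨ cong (λ Y → (U ++ Y) ++ M) Z≡ ⟩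
        (U ++ Z″ ++ ρ) ++ M  ≡⟨ ++-assoc₄ U Z″ ρ M ⟩
        (U ++ Z″) ++ ρ ++ M  ∎
        where open ≡-Reasoning

  rc-Pᵃ : ∀ {L S} → Pᵃ ≡ L ++ S → Rᵃ ≡ rc S ++ rc L
  rc-Pᵃ {L} {S} Pᵃ≡ = trans (sym (rc-pow P a)) (trans (cong rc Pᵃ≡) (rc-++ L S))

  -- A copied prefix longer than S is S Z with Z a prefix of q T, and Rᵃ continues T by rc Z rc S.
  -- Z is shorter than 4, as rc 0101 = 0101 has two 0s closer than a block; and rc S, a prefix of Rᵃ,
  -- starts a block, so |T| + |Z| is a multiple of |P|.
  right-growth : ∀ {L M} S T {Y D} → Y ++ D ≡ S ++ q ++ T → N ≤ length S →
                 Pᵃ ≡ L ++ S → Rᵃ ≡ (T ++ rc Y) ++ M →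
                 ∀ V → length T ≤ V * N → length (T ++ rc Y) ≤ length S + V * N
  right-growth {L} {M} S T {Y} {D} YD≡ N≤S Pᵃ≡ Rᵃ≡ V T≤VN with length Y ≤? length S
  ... | yes Y≤S = begin
    length (T ++ rc Y)          ≡⟨ trans (length-++ T) (cong (length T +_) (length-rc Y)) ⟩
    length T + length Y         ≤⟨ +-mono-≤ T≤VN Y≤S ⟩
    V * N + length S            ≡⟨ +-comm (V * N) (length S) ⟩
    length S + V * N            ∎
    where open ≤-Reasoning
  ... | no Y≰S with ++-split S (q ++ T) Y D (sym YD≡) (<⇒≤ (≰⇒> Y≰S))
  ...   | Z , Y≡ , qT≡ = begin
    length (T ++ rc Y)            ≡⟨ cong length (trans (cong (T ++_) (cong rc Y≡)) (cong (T ++_) (rc-++ S Z))) ⟩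
    length (T ++ rc Z ++ rc S)    ≡⟨ cong length (++-assoc T (rc Z) (rc S)) ⟨
    length ((T ++ rc Z) ++ rc S)  ≡⟨ trans (length-++ (T ++ rc Z)) (cong₂ _+_ (length-++ T) (length-rc S)) ⟩
    length T + length (rc Z) + length S
                                  ≤⟨ +-monoˡ-≤ (length S) (multiple-≤ N {length T} {length (rc Z)} {V} T≤VN Z<N aligned) ⟩
    V * N + length S              ≡⟨ +-comm (V * N) (length S) ⟩
    length S + V * N              ∎
    where
      open ≤-Reasoning
      Rᵃ≡′ : Rᵃ ≡ (T ++ rc Z) ++ rc S ++ M
      Rᵃ≡′ = trans Rᵃ≡ (trans (cong (λ X → (T ++ X) ++ M) (trans (cong rc Y≡) (rc-++ S Z)))
                              (++-assoc₄ T (rc Z) (rc S) M))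
      Z<N : length (rc Z) < N
      Z<N = subst (_< N) (sym (length-rc Z)) (≤-trans (rc-q-prefix-short {Z} {D} {T} {T} qT≡ Rᵃ≡′) (m≤m+n 4 (suc d)))
      aligned : ∃[ c ] length T + length (rc Z) ≡ c * N
      aligned = Product.map₂ (trans (sym (length-++ T)))
                  (R-zeros.aligned (T ++ rc Z) (rc S) {M} {rc L} Rᵃ≡′ (rc-Pᵃ {L} {S} Pᵃ≡)
                                   (subst (N ≤_) (sym (length-rc S)) N≤S))

  -- The mirror image of right-growth, read in Rᵃ = rc Pᵃ, with the suffix 01101 of q in place of 0101.
  left-growth : ∀ {L M} S T {D Y} → D ++ Y ≡ S ++ q ++ T → N ≤ length T →
                Pᵃ ≡ L ++ rc Y ++ S → Rᵃ ≡ T ++ M →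
                ∀ U → length S ≤ U * N → length (rc Y ++ S) ≤ length T + U * N
  left-growth {L} {M} S T {D} {Y} DY≡ N≤T Pᵃ≡ Rᵃ≡ U S≤UN with length Y ≤? length T
  ... | yes Y≤T = begin
    length (rc Y ++ S)          ≡⟨ trans (length-++ (rc Y)) (cong (_+ length S) (length-rc Y)) ⟩
    length Y + length S         ≤⟨ +-mono-≤ Y≤T S≤UN ⟩
    length T + U * N            ∎
    where open ≤-Reasoning
  ... | no Y≰T with ++-split D Y (S ++ q) T DY≡′ D≤Sq
    where
      DY≡′ : D ++ Y ≡ (S ++ q) ++ T
      DY≡′ = trans DY≡ (sym (++-assoc S q T))
      D≤Sq : length D ≤ length (S ++ q)
      D≤Sq = +-cancelʳ-≤ (length T) _ _ (begin
        length D + length T         ≤⟨ +-monoʳ-≤ (length D) (<⇒≤ (≰⇒> Y≰T)) ⟩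
        length D + length Y         ≡⟨ length-++ D ⟨
        length (D ++ Y)             ≡⟨ cong length DY≡′ ⟩
        length ((S ++ q) ++ T)      ≡⟨ length-++ (S ++ q) ⟩
        length (S ++ q) + length T  ∎)
        where open ≤-Reasoning
  ...   | Z , Sq≡ , Y≡ = begin
    length (rc Y ++ S)            ≡⟨ trans (length-++ (rc Y)) (cong (_+ length S) (length-rc Y)) ⟩
    length Y + length S           ≡⟨ cong (λ X → length X + length S) Y≡ ⟩
    length (Z ++ T) + length S    ≡⟨ cong (_+ length S) (trans (length-++ Z) (+-comm (length Z) (length T))) ⟩
    length T + length Z + length S ≡⟨ +-assoc (length T) (length Z) (length S) ⟩
    length T + (length Z + length S) ≡⟨ cong (length T +_) (+-comm (length Z) (length S)) ⟩
    length T + (length S + length Z) ≤⟨ +-monoʳ-≤ (length T) (multiple-≤ N {length S} {length Z} {U} S≤UN Z<N aligned) ⟩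
    length T + U * N              ∎
    where
      open ≤-Reasoning
      Rᵃ≡′ : Rᵃ ≡ (rc S ++ Z) ++ T ++ rc L
      Rᵃ≡′ = trans (rc-Pᵃ {L} {rc Y ++ S} Pᵃ≡)
                   (trans (cong (_++ rc L) (trans (rc-++ (rc Y) S) (cong (rc S ++_) (trans (rc-involutive Y) Y≡))))
                          (++-assoc₄ (rc S) Z T (rc L)))
      Z<N : length Z < N
      Z<N = ≤-trans (q-suffix-short {Z} {D} {S} {rc S} {T ++ rc L} Sq≡ Rᵃ≡′) (m≤m+n 5 d)
      aligned : ∃[ c ] length S + length Z ≡ c * N
      aligned = Product.map₂ (trans (sym (trans (length-++ (rc S)) (cong (_+ length Z) (length-rc S)))))
                  (R-zeros.aligned (rc S ++ Z) T {rc L} {M} Rᵃ≡′ Rᵃ≡ N≤T)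

  Bounded : ℕ → ℕ → ℕ → ℕ → Set
  Bounded U V x y = (x ≤ U * N × y ≤ V * N) ⊎ (x ≤ V * N × y ≤ U * N)

  Bounded-swap : ∀ {U V x y} → Bounded U V x y → Bounded U V y x
  Bounded-swap (inj₁ (x≤ , y≤)) = inj₂ (y≤ , x≤)
  Bounded-swap (inj₂ (x≤ , y≤)) = inj₁ (y≤ , x≤)

  Bounded-stepʳ : ∀ {U V x y y′} → U ≤ V → Bounded U V x y →
                  (∀ V′ → y ≤ V′ * N → y′ ≤ x + V′ * N) → Bounded V (U + V) x y′
  Bounded-stepʳ {U} {V} {x} U≤V (inj₁ (x≤UN , y≤VN)) grow = inj₁ (≤-trans x≤UN (*-monoˡ-≤ N U≤V) , (begin
    _                ≤⟨ grow V y≤VN ⟩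
    x + V * N        ≤⟨ +-monoˡ-≤ (V * N) x≤UN ⟩
    U * N + V * N    ≡⟨ *-distribʳ-+ N U V ⟨
    (U + V) * N      ∎))
    where open ≤-Reasoning
  Bounded-stepʳ {U} {V} {x} U≤V (inj₂ (x≤VN , y≤UN)) grow = inj₁ (x≤VN , (begin
    _                ≤⟨ grow U y≤UN ⟩
    x + U * N        ≤⟨ +-monoˡ-≤ (U * N) x≤VN ⟩
    V * N + U * N    ≡⟨ +-comm (V * N) (U * N) ⟩
    U * N + V * N    ≡⟨ *-distribʳ-+ N U V ⟨
    (U + V) * N      ∎))
    where open ≤-Reasoning

  Bounded-stepˡ : ∀ {U V x y x′} → U ≤ V → Bounded U V x y →
                  (∀ U′ → x ≤ U′ * N → x′ ≤ y + U′ * N) → Bounded V (U + V) x′ y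
  Bounded-stepˡ {U} {V} U≤V bounded grow =
    Bounded-swap {V} {U + V} (Bounded-stepʳ U≤V (Bounded-swap {U} {V} bounded) grow)

  lower-bound : ∀ n S T {U V} → N ≤ length S → N ≤ length T → U ≤ V →
                Bounded U V (length S) (length T) → Reach n (S ++ q ++ T) B → a ≤ fibFrom n U V
  lower-bound zero S T {U} {V} _ _ _ bounded r = a≤U bounded
    where
      whole : Pᵃ ≡ S × Rᵃ ≡ T ++ []
      whole = occurrence-split [] S T [] (trans (sym (Reach⇒zero r)) (sym (++-identityʳ _)))
      S≡aN : length S ≡ a * N
      S≡aN = trans (cong length (sym (proj₁ whole))) P-ones.length-Xᵃ
      T≡aN : length T ≡ a * N
      T≡aN = trans (sym (trans (cong length (proj₂ whole)) (cong length (++-identityʳ T)))) R-zeros.length-Xᵃ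
      a≤U : Bounded U V (length S) (length T) → a ≤ U
      a≤U (inj₁ (S≤UN , _)) = *-cancelʳ-≤ a U N (subst (_≤ U * N) S≡aN S≤UN)
      a≤U (inj₂ (_ , T≤UN)) = *-cancelʳ-≤ a U N (subst (_≤ U * N) T≡aN T≤UN)
  lower-bound (suc n) S T {U} {V} N≤S N≤T U≤V bounded (step (right ℓ _ _) r) with Reach⇒infix r
  ... | L , M , B≡ =
    lower-bound n S (T ++ Y) N≤S (≤-trans N≤T (length-++-≤ˡ T)) (m≤n+m V U)
      (Bounded-stepʳ {U} {V} {length S} {length T} {length (T ++ Y)} U≤V bounded
        (right-growth {L} {M} S T {take ℓ W} {drop ℓ W} (take++drop≡id ℓ W) N≤S (proj₁ halves) (proj₂ halves)))
      (subst (λ X → Reach n X B) W++Y≡ r)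
    where
      W Y : Str
      W = S ++ q ++ T
      Y = rc (take ℓ W)
      W++Y≡ : W ++ Y ≡ S ++ q ++ T ++ Y
      W++Y≡ = trans (++-assoc S (q ++ T) Y) (cong (S ++_) (++-assoc q T Y))
      halves : Pᵃ ≡ L ++ S × Rᵃ ≡ (T ++ Y) ++ M
      halves = occurrence-split L S (T ++ Y) M (trans B≡ (cong (λ X → L ++ X ++ M) W++Y≡))
  lower-bound (suc n) S T {U} {V} N≤S N≤T U≤V bounded (step (left ℓ _ _) r) with Reach⇒infix r
  ... | L , M , B≡ =
    lower-bound n (X ++ S) T (≤-trans N≤S (length-++-≤ʳ S {X})) N≤T (m≤n+m V U)
      (Bounded-stepˡ {U} {V} {length S} {length T} {length (X ++ S)} U≤V bounded
        (left-growth {L} {M} S T {take k W} {drop k W} (take++drop≡id k W) N≤T (proj₁ halves) (proj₂ halves)))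
      (subst (λ Z → Reach n Z B) X++W≡ r)
    where
      W X : Str
      k : ℕ
      W = S ++ q ++ T
      k = length W ∸ ℓ
      X = rc (drop k W)
      X++W≡ : X ++ W ≡ (X ++ S) ++ q ++ T
      X++W≡ = sym (++-assoc X S (q ++ T))
      halves : Pᵃ ≡ L ++ X ++ S × Rᵃ ≡ T ++ M
      halves = occurrence-split L (X ++ S) T M (trans B≡ (cong (λ Z → L ++ Z ++ M) X++W≡))

  Reach⇒a≤Fib[n]*k : ∀ {n k} → 1 ≤ k → Reach n (pow P k ++ q ++ pow R k) B → a ≤ Fib n * k
  Reach⇒a≤Fib[n]*k {n} {k} 1≤k r =
    subst (a ≤_) (fibFrom-scaled n k)
      (lower-bound n (pow P k) (pow R k) (N≤ P length-P) (N≤ R length-R) ≤-refl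
        (inj₁ (≤-reflexive (kN P length-P) , ≤-reflexive (kN R length-R))) r)
    where
      kN : ∀ X → length X ≡ N → length (pow X k) ≡ k * N
      kN X length-X = trans (length-pow X k) (cong (k *_) length-X)
      N≤ : ∀ X → length X ≡ N → N ≤ length (pow X k)
      N≤ X length-X = ≤-trans (≤-trans (≤-reflexive (sym (*-identityˡ N))) (*-monoˡ-≤ N 1≤k))
                              (≤-reflexive (sym (kN X length-X)))

InQ⇒affixes : ∀ {q} → InQ q → (∃[ u ] q ≡ false ∷ true ∷ false ∷ true ∷ u) ×
                              (∃[ v ] q ≡ v ++ false ∷ true ∷ true ∷ false ∷ true ∷ [])
InQ⇒affixes (w₁ , w₂ , refl) =
  (_ , refl) ,
  (false ∷ true ∷ false ∷ true ∷ w₁ ++ true ∷ true ∷ false ∷ false ∷ w₂ ,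
   cong (λ X → false ∷ true ∷ false ∷ true ∷ X)
            (sym (++-assoc w₁ (true ∷ true ∷ false ∷ false ∷ w₂) (false ∷ true ∷ true ∷ false ∷ true ∷ []))))

lemma34 : (ext : ℕ) → 3 ≤ ext → (q : Str) → InQ q →
    (a k : ℕ) → 1 ≤ k → k ≤ a → (m : ℕ) → FibInvIs a k m →
    HCDis (pow (per ext) k ++ q ++ pow (rc (per ext)) k)
          (pow (per ext) a ++ q ++ pow (rc (per ext)) a) m
lemma34 (suc (suc (suc d))) (s≤s (s≤s (s≤s z≤n))) q q∈Q a k 1≤k k≤a m Fib⁻¹
  with InQ⇒affixes q∈Q
... | (u , q-prefix) , (v , q-suffix) =
  Blocks.reach-Fib⁻¹ (per (3 + d)) q (s≤s z≤n) 1≤k k≤a Fib⁻¹ ,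
  λ n r → proj₂ Fib⁻¹ n (LowerBound.Reach⇒a≤Fib[n]*k d q u v q-prefix q-suffix a 1≤k r)
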